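{- For all $n\ge0$, \[ a_3(\lfloor n/4\rfloor)\oplus a_5(n)\oplus a_7(n)=a_7(\lfloor n/64\rfloor). \]
   Context: For $n\ge0$ write $b_p(n)=\lfloor n/2^p\rfloor\bmod 2$; $\oplus$ is XOR and $\&$ is bitwise AND. For $m\ge0$, $a_m(n)=\bigoplus_{p\ge0,\ p\,\&\,m=0}b_p(n)$. -}

module Defs where

open import Data.Nat using (ℕ; zero; suc; _^_; _/_; _%_; _≡ᵇ_)
open import Data.Nat.Properties using (m^n≢0)
open import Data.Bool using (Bool; true; false; _xor_; _∧_; not; if_then_else_)

bit : ℕ → ℕ → Bool
bit p n = ((_/_ n (2 ^ p) {{m^n≢0 2 p}}) % 2) ≡ᵇ 1

-- p & m = 0 : no bit position q has b_q(p) = b_q(m) = 1.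
-- Only positions q < p can have b_q(p) = 1 (p < 2^p), so checking q < p is exhaustive.
disjointUpTo : ℕ → ℕ → ℕ → Bool
disjointUpTo zero    p m = true
disjointUpTo (suc k) p m = not (bit k p ∧ bit k m) ∧ disjointUpTo k p m

andZero : ℕ → ℕ → Bool
andZero p m = disjointUpTo p p m

aUpTo : ℕ → ℕ → ℕ → Bool
aUpTo zero    m n = false
aUpTo (suc k) m n = (if andZero k m then bit k n else false) xor aUpTo k m n

-- a_m(n) = XOR over all p ≥ 0 with p & m = 0 of b_p(n).
-- b_p(n) = 0 for p ≥ n (n < 2^n), so the range p < n is exhaustive.
a : ℕ → ℕ → Bool
a m n = aUpTo n m n

-- For m < 8 the condition p & m = 0 depends only on p mod 8. After shifting indices, all four
-- terms are XORs of bits b_q(n) of n itself: a_3(⌊n/4⌋) over q ≡ 2 (mod 4) with q ≥ 2, a_5(n)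
-- over q ≡ 0, 2 (mod 8), a_7(n) over q ≡ 0 (mod 8), and a_7(⌊n/64⌋) over q ≡ 6 (mod 8). The
-- indicators of the first three sets XOR to the fourth, which is checked on one period.
module Submission where

open import Defs
open import Data.Nat using (ℕ; _/_)
open import Data.Bool using (Bool; _xor_)
open import Relation.Binary.PropositionalEquality using (_≡_)

open import Algebra.Bundles using (CommutativeRing)
open import Data.Bool using (true; false; not; _∧_; if_then_else_; T)
open import Data.Bool.Properties
  using (∧-zeroʳ; ∧-distribʳ-xor; xor-identityʳ; xor-∧-commutativeRing)
open import Data.Nat
  using (zero; suc; _+_; _*_; _∸_; _^_; _%_; _≡ᵇ_; _<ᵇ_; _≤_; _<_; z≤n; s≤s)
open import Data.Nat.DivMod
  using (m/n/o≡m/[n*o]; /-congʳ; m<n⇒m/n≡0; m/n≤m; m*n/n≡m; +-distrib-/-∣ˡ; [m+kn]%n≡m%n)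
open import Data.Nat.Divisibility using (divides)
open import Data.Nat.Properties
  using (+-identityʳ; +-suc; +-comm; *-assoc; +-mono-≤; ≤-refl; ≤-trans; ≤-total; m<n⇒m<1+n;
         m≤m+n; m≤n+m; m+[n∸m]≡n; m∸n+n≡m; m^n>0; m^n≢0; m*n≢0; ^-monoʳ-≤; ^-distribˡ-+-*; <ᵇ⇒<)
open import Data.Sum using (inj₁; inj₂)
open import Relation.Binary.PropositionalEquality
  using (refl; sym; trans; cong; cong₂; subst; module ≡-Reasoning)
open import Algebra.Properties.CommutativeSemigroup
  (CommutativeRing.+-commutativeSemigroup xor-∧-commutativeRing)
  using (interchange; x∙yz≈y∙xz)

open ≡-Reasoning

xorSum : ℕ → (ℕ → Bool) → Bool
xorSum zero    f = false
xorSum (suc k) f = f k xor xorSum k f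

xorSum-cong : ∀ k {f g} → (∀ p → f p ≡ g p) → xorSum k f ≡ xorSum k g
xorSum-cong zero    f≗g = refl
xorSum-cong (suc k) f≗g = cong₂ _xor_ (f≗g k) (xorSum-cong k f≗g)

xorSum-xor : ∀ k f g → xorSum k f xor xorSum k g ≡ xorSum k (λ p → f p xor g p)
xorSum-xor zero    f g = refl
xorSum-xor (suc k) f g =
  trans (interchange (f k) (xorSum k f) (g k) (xorSum k g))
        (cong ((f k xor g k) xor_) (xorSum-xor k f g))

xorSum-false : ∀ k {f} → (∀ p → f p ≡ false) → xorSum k f ≡ false
xorSum-false zero    f≗false = refl
xorSum-false (suc k) f≗false = cong₂ _xor_ (f≗false k) (xorSum-false k f≗false)

xorSum-+ : ∀ j k f → xorSum (j + k) f ≡ xorSum j f xor xorSum k (λ p → f (j + p))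
xorSum-+ j zero    f = trans (cong (λ i → xorSum i f) (+-identityʳ j)) (sym (xor-identityʳ _))
xorSum-+ j (suc k) f = begin
  xorSum (j + suc k) f                                      ≡⟨ cong (λ i → xorSum i f) (+-suc j k) ⟩
  f (j + k) xor xorSum (j + k) f                            ≡⟨ cong (f (j + k) xor_) (xorSum-+ j k f) ⟩
  f (j + k) xor (xorSum j f xor xorSum k (λ p → f (j + p))) ≡⟨ x∙yz≈y∙xz (f (j + k)) (xorSum j f) _ ⟩
  xorSum j f xor xorSum (suc k) (λ p → f (j + p))           ∎

xorSum-extend : ∀ {j k} f → j ≤ k → (∀ p → j ≤ p → f p ≡ false) → xorSum k f ≡ xorSum j f
xorSum-extend {j} {k} f j≤k vanish = begin
  xorSum k f                                          ≡⟨ cong (λ i → xorSum i f) (sym (m+[n∸m]≡n j≤k)) ⟩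
  xorSum (j + (k ∸ j)) f                              ≡⟨ xorSum-+ j (k ∸ j) f ⟩
  xorSum j f xor xorSum (k ∸ j) (λ p → f (j + p))     ≡⟨ cong (xorSum j f xor_) tail-false ⟩
  xorSum j f xor false                                ≡⟨ xor-identityʳ _ ⟩
  xorSum j f                                          ∎
  where
  tail-false : xorSum (k ∸ j) (λ p → f (j + p)) ≡ false
  tail-false = xorSum-false (k ∸ j) (λ p → vanish (j + p) (m≤m+n j p))

n<2^n : ∀ n → n < 2 ^ n
n<2^n zero    = s≤s z≤n
n<2^n (suc n) = +-mono-≤ (m^n>0 2 n) (subst (suc n ≤_) (sym (+-identityʳ (2 ^ n))) (n<2^n n))

bit-<2^ : ∀ p {n} → n < 2 ^ p → bit p n ≡ false
bit-<2^ p n<2^p = cong (λ x → x % 2 ≡ᵇ 1) (m<n⇒m/n≡0 {{m^n≢0 2 p}} n<2^p)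

bit-≥ : ∀ {p n} → n ≤ p → bit p n ≡ false
bit-≥ {p} {n} n≤p = bit-<2^ p (≤-trans (n<2^n n) (^-monoʳ-≤ 2 n≤p))

bit-/2^ : ∀ k p n → bit p (_/_ n (2 ^ k) {{m^n≢0 2 k}}) ≡ bit (k + p) n
bit-/2^ k p n = cong (λ x → x % 2 ≡ᵇ 1) (begin
  n / 2 ^ k / 2 ^ p     ≡⟨ m/n/o≡m/[n*o] n (2 ^ k) (2 ^ p) ⟩
  n / (2 ^ k * 2 ^ p)   ≡⟨ /-congʳ (sym (^-distribˡ-+-* 2 k p)) ⟩
  n / 2 ^ (k + p)       ∎)
  where instance _ = m^n≢0 2 k
                 _ = m^n≢0 2 p
                 _ = m^n≢0 2 (k + p)
                 _ = m*n≢0 (2 ^ k) (2 ^ p)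

bit-periodic : ∀ p j n → bit p (j * 2 ^ suc p + n) ≡ bit p n
bit-periodic p j n = cong (_≡ᵇ 1) (begin
  (j * 2 ^ suc p + n) / 2 ^ p % 2   ≡⟨ cong (_% 2) (+-distrib-/-∣ˡ n (divides (j * 2) (sym (*-assoc j 2 (2 ^ p))))) ⟩
  (j * 2 ^ suc p / 2 ^ p + n / 2 ^ p) % 2
                                    ≡⟨ cong (λ x → (x + n / 2 ^ p) % 2)
                                         (trans (cong (_/ 2 ^ p) (sym (*-assoc j 2 (2 ^ p)))) (m*n/n≡m (j * 2) (2 ^ p))) ⟩
  (j * 2 + n / 2 ^ p) % 2           ≡⟨ cong (_% 2) (+-comm (j * 2) (n / 2 ^ p)) ⟩
  (n / 2 ^ p + j * 2) % 2           ≡⟨ [m+kn]%n≡m%n (n / 2 ^ p) j 2 ⟩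
  n / 2 ^ p % 2                     ∎)
  where instance _ = m^n≢0 2 p

bit-+2^ : ∀ {p k} → p < k → ∀ n → bit p (2 ^ k + n) ≡ bit p n
bit-+2^ {p} {k} p<k n = trans (cong (λ x → bit p (x + n)) 2^k≡j*2^[1+p]) (bit-periodic p (2 ^ (k ∸ suc p)) n)
  where
  2^k≡j*2^[1+p] : 2 ^ k ≡ 2 ^ (k ∸ suc p) * 2 ^ suc p
  2^k≡j*2^[1+p] = trans (cong (2 ^_) (sym (m∸n+n≡m p<k))) (^-distribˡ-+-* 2 (k ∸ suc p) (suc p))

disjointUpTo-cong : ∀ k {p p′} m → (∀ q → q < k → bit q p ≡ bit q p′) →
                    disjointUpTo k p m ≡ disjointUpTo k p′ m
disjointUpTo-cong zero    m same = refl
disjointUpTo-cong (suc k) m same =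
  cong₂ (λ b rest → not (b ∧ bit k m) ∧ rest) (same k ≤-refl)
        (disjointUpTo-cong k m (λ q q<k → same q (m<n⇒m<1+n q<k)))

disjointUpTo-+ : ∀ j d p m → (∀ q → j ≤ q → bit q p ∧ bit q m ≡ false) →
                 disjointUpTo (d + j) p m ≡ disjointUpTo j p m
disjointUpTo-+ j zero    p m disjoint = refl
disjointUpTo-+ j (suc d) p m disjoint
  rewrite disjoint (d + j) (m≤n+m j d) = disjointUpTo-+ j d p m disjoint

disjointUpTo-extend : ∀ {j k} p m → j ≤ k → (∀ q → j ≤ q → bit q p ∧ bit q m ≡ false) →
                      disjointUpTo k p m ≡ disjointUpTo j p m
disjointUpTo-extend {j} {k} p m j≤k disjoint =
  trans (cong (λ i → disjointUpTo i p m) (sym (m∸n+n≡m j≤k))) (disjointUpTo-+ j (k ∸ j) p m disjoint)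

andZero-disjointUpTo : ∀ k {m} p → m < 2 ^ k → andZero p m ≡ disjointUpTo k p m
andZero-disjointUpTo k {m} p m<2^k with ≤-total p k
... | inj₁ p≤k = sym (disjointUpTo-extend p m p≤k (λ q p≤q → cong (_∧ bit q m) (bit-≥ p≤q)))
... | inj₂ k≤p = disjointUpTo-extend p m k≤p (λ q k≤q → trans (cong (bit q p ∧_) (m-vanishes k≤q)) (∧-zeroʳ _))
  where
  m-vanishes : ∀ {q} → k ≤ q → bit q m ≡ false
  m-vanishes {q} k≤q = bit-<2^ q (≤-trans m<2^k (^-monoʳ-≤ 2 k≤q))

andZero-+2^ : ∀ k {m} → m < 2 ^ k → ∀ p → andZero (2 ^ k + p) m ≡ andZero p m
andZero-+2^ k {m} m<2^k p = begin
  andZero (2 ^ k + p) m          ≡⟨ andZero-disjointUpTo k (2 ^ k + p) m<2^k ⟩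
  disjointUpTo k (2 ^ k + p) m   ≡⟨ disjointUpTo-cong k m (λ q q<k → bit-+2^ q<k p) ⟩
  disjointUpTo k p m             ≡⟨ andZero-disjointUpTo k p m<2^k ⟨
  andZero p m                    ∎

aUpTo-xorSum : ∀ k m n → aUpTo k m n ≡ xorSum k (λ p → andZero p m ∧ bit p n)
aUpTo-xorSum zero    m n = refl
aUpTo-xorSum (suc k) m n = cong₂ _xor_ (if-then-false (andZero k m)) (aUpTo-xorSum k m n)
  where
  if-then-false : ∀ b {x} → (if b then x else false) ≡ b ∧ x
  if-then-false true  = refl
  if-then-false false = refl

a-xorSum : ∀ m {n N} → n ≤ N → a m n ≡ xorSum N (λ p → andZero p m ∧ bit p n)
a-xorSum m {n} n≤N = trans (aUpTo-xorSum n m n) (sym (xorSum-extend _ n≤N vanish))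
  where
  vanish : ∀ p → n ≤ p → andZero p m ∧ bit p n ≡ false
  vanish p n≤p = trans (cong (andZero p m ∧_) (bit-≥ n≤p)) (∧-zeroʳ _)

a-/2^-xorSum : ∀ m k {n N} → n ≤ N →
               a m (_/_ n (2 ^ k) {{m^n≢0 2 k}}) ≡ xorSum N (λ p → andZero p m ∧ bit (k + p) n)
a-/2^-xorSum m k {n} {N} n≤N =
  trans (a-xorSum m (≤-trans (m/n≤m n (2 ^ k) {{m^n≢0 2 k}}) n≤N))
        (xorSum-cong N (λ p → cong (andZero p m ∧_) (bit-/2^ k p n)))

-- The indicator identity, indexed by the bit position q = 6 + p of n; it has period 8 in p.
andZero-mask-identity : ∀ p → (andZero (4 + p) 3 xor andZero (6 + p) 5) xor andZero (6 + p) 7 ≡ andZero p 7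
andZero-mask-identity 0 = refl
andZero-mask-identity 1 = refl
andZero-mask-identity 2 = refl
andZero-mask-identity 3 = refl
andZero-mask-identity 4 = refl
andZero-mask-identity 5 = refl
andZero-mask-identity 6 = refl
andZero-mask-identity 7 = refl
andZero-mask-identity (suc (suc (suc (suc (suc (suc (suc (suc t)))))))) = begin
  (andZero (8 + (4 + t)) 3 xor andZero (8 + (6 + t)) 5) xor andZero (8 + (6 + t)) 7
    ≡⟨ cong₂ _xor_ (cong₂ _xor_ (period 3 (4 + t)) (period 5 (6 + t))) (period 7 (6 + t)) ⟩
  (andZero (4 + t) 3 xor andZero (6 + t) 5) xor andZero (6 + t) 7
    ≡⟨ andZero-mask-identity t ⟩
  andZero t 7
    ≡⟨ period 7 t ⟨
  andZero (8 + t) 7 ∎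
  where
  period : ∀ m {m<8 : T (m <ᵇ 8)} p → andZero (8 + p) m ≡ andZero p m
  period m {m<8} = andZero-+2^ 3 (<ᵇ⇒< m 8 m<8)

xorSum-mask-identity : ∀ k (B : ℕ → Bool) →
  (xorSum k (λ p → andZero (4 + p) 3 ∧ B p) xor xorSum k (λ p → andZero (6 + p) 5 ∧ B p))
    xor xorSum k (λ p → andZero (6 + p) 7 ∧ B p)
  ≡ xorSum k (λ p → andZero p 7 ∧ B p)
xorSum-mask-identity k B = begin
  (xorSum k (λ p → A₃ p ∧ B p) xor xorSum k (λ p → A₅ p ∧ B p)) xor xorSum k (λ p → A₇ p ∧ B p)
    ≡⟨ cong (_xor xorSum k (λ p → A₇ p ∧ B p)) (xorSum-xor k _ _) ⟩
  xorSum k (λ p → (A₃ p ∧ B p) xor (A₅ p ∧ B p)) xor xorSum k (λ p → A₇ p ∧ B p)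
    ≡⟨ xorSum-xor k _ _ ⟩
  xorSum k (λ p → ((A₃ p ∧ B p) xor (A₅ p ∧ B p)) xor (A₇ p ∧ B p))
    ≡⟨ xorSum-cong k (λ p → trans (sym (factor p)) (cong (_∧ B p) (andZero-mask-identity p))) ⟩
  xorSum k (λ p → andZero p 7 ∧ B p) ∎
  where
  A₃ A₅ A₇ : ℕ → Bool
  A₃ p = andZero (4 + p) 3
  A₅ p = andZero (6 + p) 5
  A₇ p = andZero (6 + p) 7

  factor : ∀ p → ((A₃ p xor A₅ p) xor A₇ p) ∧ B p ≡ ((A₃ p ∧ B p) xor (A₅ p ∧ B p)) xor (A₇ p ∧ B p)
  factor p = trans (∧-distribʳ-xor (B p) (A₃ p xor A₅ p) (A₇ p))
                   (cong (_xor (A₇ p ∧ B p)) (∧-distribʳ-xor (B p) (A₃ p) (A₅ p)))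

xor-regroup : ∀ x x′ y y′ z z′ →
              ((x xor x′) xor (y xor y′)) xor (z xor z′) ≡ ((x xor y) xor z) xor ((x′ xor y′) xor z′)
xor-regroup x x′ y y′ z z′ =
  trans (cong (_xor (z xor z′)) (interchange x x′ y y′)) (interchange (x xor y) (x′ xor y′) z z′)

proposition31 : (n : ℕ) → (a 3 (n / 4) xor a 5 n) xor a 7 n ≡ a 7 (n / 64)
proposition31 n = begin
  (a 3 (n / 4) xor a 5 n) xor a 7 n
    ≡⟨ cong₂ _xor_ (cong₂ _xor_ (split 3 2 4 (a-/2^-xorSum 3 2 (m≤n+m n 4)))
                                (split 5 0 6 (a-xorSum 5 (m≤n+m n 6))))
                   (split 7 0 6 (a-xorSum 7 (m≤n+m n 6))) ⟩
  ((low 3 2 4 xor high 3 2 4) xor (low 5 0 6 xor high 5 0 6)) xor (low 7 0 6 xor high 7 0 6)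
    ≡⟨ xor-regroup (low 3 2 4) (high 3 2 4) (low 5 0 6) (high 5 0 6) (low 7 0 6) (high 7 0 6) ⟩
  ((low 3 2 4 xor low 5 0 6) xor low 7 0 6) xor ((high 3 2 4 xor high 5 0 6) xor high 7 0 6)
    ≡⟨ cong₂ _xor_ (low-positions-cancel (bit 0 n) (bit 2 n)) (xorSum-mask-identity n (λ p → bit (6 + p) n)) ⟩
  xorSum n (λ p → andZero p 7 ∧ bit (6 + p) n)
    ≡⟨ a-/2^-xorSum 7 6 (≤-refl {n}) ⟨
  a 7 (n / 64) ∎
  where
  summand : ℕ → ℕ → ℕ → Bool
  summand m s p = andZero p m ∧ bit (s + p) n

  low high : ℕ → ℕ → ℕ → Bool
  low  m s l = xorSum l (summand m s)
  high m s l = xorSum n (λ p → summand m s (l + p))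

  split : ∀ m s l {x} → x ≡ xorSum (l + n) (summand m s) → x ≡ low m s l xor high m s l
  split m s l x≡sum = trans x≡sum (xorSum-+ l n (summand m s))

  -- The low sums evaluate to b₂, b₂ ⊕ b₀ and b₀.
  low-positions-cancel : ∀ b₀ b₂ → ((b₂ xor false) xor (b₂ xor (b₀ xor false))) xor (b₀ xor false) ≡ false
  low-positions-cancel false false = refl
  low-positions-cancel false true  = refl
  low-positions-cancel true  false = refl
  low-positions-cancel true  true  = refl
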